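{- Let $G=(V,E)$ be a connected proper chordal graph, $(T,r,\rho)$ an indifference tree-layout of $G$, and $x$ a vertex with $x\neq\rho^{ -1}(r)$ such that $B(x)$ is an inclusion-maximal member of $\{B(y):y\in V\}$. Let $C(x)$ be the connected component of $G-A(x)$ containing $x$, let $C_1,\dots,C_k$ be the connected components of $G[C(x)\setminus B(x)]$, and for $1\le i\le k$ let $\mathcal{N}_i=\{N(y)\cap B(x): y\in C_i,\ N(y)\cap B(x)\neq\emptyset\}$. Then each $\mathcal{N}_i$ is a nested set, and $\textsf{Nested-Convex}(\langle\mathcal{N}_1,\dots,\mathcal{N}_k\rangle,\mathcal{S}_x)\neq\emptyset$, where $\mathcal{S}_x=\bigcup_{i=1}^k\mathcal{N}_i$.
   Context: A tree-layout of $G=(V,E)$ is a triple $(T,r,\rho)$ with $T$ a tree on $|V|$ nodes rooted at $r$ and $\rho:V\to V(T)$ a bijection such that for every edge $xy$, $\rho(x)$ is an ancestor of $\rho(y)$ or vice versa. Write $u\prec v$ if $\rho(u)$ is a proper ancestor of $\rho(v)$; $A(v)=\{u:u\prec v\}$. $G$ is proper chordal if it admits a tree-layout with no $x\prec y\prec z$ such that $xz\in E$ and exactly one of $xy,yz$ is in $E$. An indifference tree-layout is a tree-layout with no $x\prec y\prec z$ such that $xz\in E$ and ($xy\notin E$ or $yz\notin E$). For $S\subseteq V$, $N(S)$ is the set of vertices outside $S$ with a neighbour in $S$. For nonempty $S$ and a component $C$ of $G-S$, $v\in C$ is $S$-maximal if $N(w)\cap S\subseteq N(v)\cap S$ for every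 $w\in C$; $v$ is $U$-universal if $v$ is adjacent to every vertex of $U\setminus\{v\}$. The $S$-block of $C$ is the set of vertices of $C$ that are $S$-maximal and $(N(S)\cap C)$-universal. For $y\ne\rho^{ -1}(r)$, $B(y)$ is the $A(y)$-block of the component of $G-A(y)$ containing $y$; for the root vertex, $B(y)=\{y\}$. A family $\mathcal{N}$ of sets is nested if any two members are comparable by inclusion. For a collection $\mathcal{C}=\langle\mathcal{N}_1,\dots,\mathcal{N}_k\rangle$ of nested families of subsets of a set $X$ and $\mathcal{S}=\bigcup_i\mathcal{N}_i$, $\textsf{Nested-Convex}(\mathcal{C},\mathcal{S})$ is the set of permutations $\sigma$ of $X$ in which every member of $\mathcal{S}$ is consecutive and such that for every $i$ and $Y,Z\in\mathcal{N}_i$ with $Z\subsetneq Y$, all elements of $Y\setminus Z$ precede all elements of $Z$ in $\sigma$. -}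

module Defs where

open import Data.Nat using (ℕ)
open import Data.Fin using (Fin)
open import Data.Bool using (Bool; true; false; T)
open import Data.Maybe using (Maybe; just; nothing)
open import Data.Unit using (⊤)
open import Data.Product using (Σ; ∃; ∃-syntax; _×_; _,_)
open import Data.Sum using (_⊎_)
open import Data.List using (List; []; _∷_; _++_)
open import Data.List.Membership.Propositional using (_∈_)
open import Data.List.Relation.Unary.Unique.Propositional using (Unique)
open import Relation.Nullary using (¬_)
open import Relation.Binary.PropositionalEquality using (_≡_; _≢_)
open import Function.Definitions using (Bijective)

VSet : ℕ → Set₁
VSet n = Fin n → Set

_⊆_ : ∀ {n} → VSet n → VSet n → Set
S ⊆ S' = ∀ v → S v → S' v

_⊂_ : ∀ {n} → VSet n → VSet n → Set
Z ⊂ Y = Z ⊆ Y × ∃[ v ] (Y v × ¬ Z v)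

record Graph (n : ℕ) : Set where
  field
    adj    : Fin n → Fin n → Bool
    sym    : ∀ u v → adj u v ≡ adj v u
    irrefl : ∀ u → adj u u ≡ false

E : ∀ {n} → Graph n → Fin n → Fin n → Set
E G u v = T (Graph.adj G u v)

-- Reach G W u v : there is a path from u to v in G[W] (u, v ∈ W).
-- Reach G W u is the connected component of G[W] containing u.
data Reach {n} (G : Graph n) (W : VSet n) : Fin n → Fin n → Set where
  here : ∀ {u} → W u → Reach G W u u
  step : ∀ {u w v} → W u → E G u w → Reach G W w v → Reach G W u v

Connected : ∀ {n} → Graph n → Set
Connected G = ∀ u v → Reach G (λ _ → ⊤) u v

data Anc {m} (p : Fin m → Maybe (Fin m)) : Fin m → Fin m → Set where
  anc-refl : ∀ {t} → Anc p t t
  anc-step : ∀ {t u w} → p u ≡ just w → Anc p t w → Anc p t u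

record RootedTree (m : ℕ) : Set where
  field
    parent      : Fin m → Maybe (Fin m)
    root        : Fin m
    root-parent : parent root ≡ nothing
    reaches     : ∀ t → Anc parent root t

record TreeLayout {n} (G : Graph n) : Set where
  field
    tree  : RootedTree n
    ρ     : Fin n → Fin n
    ρ-bij : Bijective _≡_ _≡_ ρ
    edges : ∀ x y → E G x y →
            Anc (RootedTree.parent tree) (ρ x) (ρ y) ⊎ Anc (RootedTree.parent tree) (ρ y) (ρ x)

module _ {n} {G : Graph n} (L : TreeLayout G) where
  open TreeLayout L
  open RootedTree tree

  Prec : Fin n → Fin n → Set
  Prec u v = Anc parent (ρ u) (ρ v) × ρ u ≢ ρ v

  A : Fin n → VSet n
  A v u = Prec u v

  IsRootVertex : Fin n → Set
  IsRootVertex y = ρ y ≡ root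

  ProperChordalLayout : Set
  ProperChordalLayout = ∀ x y z → Prec x y → Prec y z → E G x z →
    ¬ ((E G x y × ¬ E G y z) ⊎ (¬ E G x y × E G y z))

  IndifferenceLayout : Set
  IndifferenceLayout = ∀ x y z → Prec x y → Prec y z → E G x z →
    ¬ (¬ E G x y ⊎ ¬ E G y z)

ProperChordal : ∀ {n} → Graph n → Set
ProperChordal G = Σ (TreeLayout G) ProperChordalLayout

module _ {n} (G : Graph n) where

  Nbh : VSet n → VSet n
  Nbh S v = ¬ S v × ∃[ s ] (S s × E G v s)

  SMaximal : VSet n → VSet n → Fin n → Set
  SMaximal S C v = C v × (∀ w → C w → ∀ s → S s → E G w s → E G v s)

  Universal : VSet n → Fin n → Set
  Universal U v = ∀ u → U u → u ≢ v → E G v u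

  Block : VSet n → VSet n → VSet n
  Block S C v = C v × SMaximal S C v × Universal (λ u → Nbh S u × C u) v

  CompMinus : VSet n → Fin n → VSet n
  CompMinus S y = Reach G (λ w → ¬ S w) y

Bset : ∀ {n} {G : Graph n} → TreeLayout G → Fin n → VSet n
Bset {G = G} L y v =
  (IsRootVertex L y × v ≡ y) ⊎
  (¬ IsRootVertex L y × Block G (A L y) (CompMinus G (A L y) y) v)

-- Nested families and Nested-Convex
-- A collection ⟨N_i⟩_{i : I} of families; the members of N_i are the
-- sets F i m for m : M i.

Nested : ∀ {n} (M : Set) (F : M → VSet n) → Set
Nested M F = ∀ m m' → F m ⊆ F m' ⊎ F m' ⊆ F m

IsPermOf : ∀ {n} → List (Fin n) → VSet n → Set
IsPermOf σ X = Unique σ × (∀ v → (v ∈ σ → X v) × (X v → v ∈ σ))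

Consecutive : ∀ {n} → List (Fin n) → VSet n → Set
Consecutive σ Y = ∃[ L ] ∃[ M ] ∃[ R ]
  (σ ≡ L ++ M ++ R × (∀ v → (v ∈ M → Y v) × (Y v → v ∈ M)))

Before : ∀ {n} → List (Fin n) → Fin n → Fin n → Set
Before σ v w = ∃[ L₁ ] ∃[ L₂ ] ∃[ L₃ ] (σ ≡ L₁ ++ v ∷ L₂ ++ w ∷ L₃)

NestedConvex : ∀ {n} (X : VSet n) (I : Set) (M : I → Set)
               (F : (i : I) → M i → VSet n) → List (Fin n) → Set
NestedConvex X I M F σ =
  IsPermOf σ X ×
  (∀ i m → Consecutive σ (F i m)) ×
  (∀ i m m' → F i m' ⊂ F i m →
     ∀ v w → F i m v → ¬ F i m' v → F i m' w → Before σ v w)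

{-# OPTIONS --safe #-}

-- In an indifference layout, a ≺ b ≺ c and ac ∈ E force ab, bc ∈ E. Consequently
-- B(x) is a clique, hence a chain of the tree; a vertex y of C(x) ∖ B(x) lies below
-- each of its neighbours b in B(x), and b stays above every vertex of the component
-- of y; and N(y) ∩ B(x) is closed upwards: b ≺ b' ≺ y with b ∈ N(y) gives b' ∈ N(y).
-- Listing B(x) from the root downwards then makes every N(y) ∩ B(x) consecutive, and
-- for y, y' in one component the upward closure makes N(y) ∩ B(x) and N(y') ∩ B(x)
-- comparable, with the extra elements of the larger set lying above those of the smaller.
module Submission where

open import Defs
open import Data.Nat using (ℕ; suc; _+_; _≤_; _<_; s≤s)
open import Data.Nat.Properties using (m≤n+m; <⇒≱; 1+n≢n; ≤-decTotalOrder)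
open import Data.Fin using (Fin; _≟_)
open import Data.Fin.Properties using (all?; any?; ¬∀⟶∃¬)
open import Data.Bool using (T)
open import Data.Maybe using (just)
open import Data.Maybe.Properties using (just-injective)
open import Data.Product using (Σ; ∃₂; ∃-syntax; _×_; _,_; proj₁; proj₂)
open import Data.Sum using (_⊎_; inj₁; inj₂)
open import Data.List using (List; []; _∷_; _++_; filter; allFin)
open import Data.List.Membership.Propositional using (_∈_)
open import Data.List.Membership.Propositional.Properties
  using (∈-++⁺ʳ; ∈-++⁻; ∈-∃++; ∈-filter⁺; ∈-filter⁻; ∈-allFin)
open import Data.List.Relation.Unary.Any as Any using (here; there)
open import Data.List.Relation.Unary.All as All using (All; []; _∷_)
open import Data.List.Relation.Unary.AllPairs using (AllPairs; _∷_)
open import Data.List.Relation.Unary.Unique.Propositional using (Unique)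
open import Data.List.Relation.Unary.Unique.Propositional.Properties using (allFin⁺; filter⁺)
open import Data.List.Relation.Unary.Sorted.TotalOrder.Properties using (Sorted⇒AllPairs)
open import Data.List.Relation.Binary.Permutation.Propositional using (↭-sym; ↭⇒↭ₛ)
open import Data.List.Relation.Binary.Permutation.Propositional.Properties using (∈-resp-↭)
import Data.List.Relation.Binary.Permutation.Setoid.Properties as SetoidPermutation
import Data.List.Sort as Sort
import Relation.Binary.Construct.On as On
open import Relation.Binary.Bundles using (DecTotalOrder)
open import Relation.Nullary using (¬_; Dec; yes; no; contradiction)
open import Relation.Nullary.Decidable using (_×-dec_; _→-dec_; ¬?; T?; map′; decidable-stable)
open import Relation.Binary.PropositionalEquality
open import Function using (_∘′_)

module AncestorOrder {m : ℕ} (T : RootedTree m) where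
  open RootedTree T

  parent-unique : ∀ {t w w'} → parent t ≡ just w → parent t ≡ just w' → w ≡ w'
  parent-unique e e' = just-injective (trans (sym e) e')

  anc-trans : ∀ {a b c} → Anc parent a b → Anc parent b c → Anc parent a c
  anc-trans d anc-refl = d
  anc-trans d (anc-step e d') = anc-step e (anc-trans d d')

  anc-length : ∀ {a b} → Anc parent a b → ℕ
  anc-length anc-refl = 0
  anc-length (anc-step _ d) = suc (anc-length d)

  anc-length-trans : ∀ {a b c} (d : Anc parent a b) (d' : Anc parent b c) →
                     anc-length (anc-trans d d') ≡ anc-length d' + anc-length d
  anc-length-trans d anc-refl = refl
  anc-length-trans d (anc-step _ d') = cong suc (anc-length-trans d d')

  anc-root-length-unique : ∀ {t} (d d' : Anc parent root t) → anc-length d ≡ anc-length d'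
  anc-root-length-unique anc-refl anc-refl = refl
  anc-root-length-unique anc-refl (anc-step e _) with trans (sym root-parent) e
  ... | ()
  anc-root-length-unique (anc-step e _) anc-refl with trans (sym root-parent) e
  ... | ()
  anc-root-length-unique (anc-step e d) (anc-step e' d') with parent-unique e e'
  ... | refl = cong suc (anc-root-length-unique d d')

  depth : Fin m → ℕ
  depth t = anc-length (reaches t)

  depth-anc : ∀ {a b} (d : Anc parent a b) → depth b ≡ anc-length d + depth a
  depth-anc {a} {b} d =
    trans (anc-root-length-unique (reaches b) (anc-trans (reaches a) d)) (anc-length-trans (reaches a) d)

  depth-≤ : ∀ {a b} → Anc parent a b → depth a ≤ depth b
  depth-≤ {a} d = subst (depth a ≤_) (sym (depth-anc d)) (m≤n+m (depth a) (anc-length d))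

  depth-< : ∀ {a b} → Anc parent a b → a ≢ b → depth a < depth b
  depth-< anc-refl a≢b = contradiction refl a≢b
  depth-< {a} d@(anc-step _ d') _ =
    subst (depth a <_) (sym (depth-anc d)) (s≤s (m≤n+m (depth a) (anc-length d')))

  anc-antisym : ∀ {a b} → Anc parent a b → Anc parent b a → a ≡ b
  anc-antisym {a} {b} d d' with a ≟ b
  ... | yes a≡b = a≡b
  ... | no a≢b = contradiction (depth-≤ d') (<⇒≱ (depth-< d a≢b))

  parent-proper : ∀ {t w} → parent t ≡ just w → Anc parent w t × w ≢ t
  parent-proper e = anc-step e anc-refl , λ { refl → 1+n≢n (sym (depth-anc (anc-step e anc-refl))) }

  anc-parent : ∀ {a t w} → Anc parent a t → a ≢ t → parent t ≡ just w → Anc parent a w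
  anc-parent anc-refl a≢t _ = contradiction refl a≢t
  anc-parent (anc-step e d) _ e' with parent-unique e e'
  ... | refl = d

  parent⇒¬anc-root : ∀ {t w} → parent t ≡ just w → ¬ Anc parent t root
  parent⇒¬anc-root e d with anc-antisym d (reaches _)
  ... | refl with trans (sym root-parent) e
  ...   | ()

  anc-comparable : ∀ {a b c} → Anc parent a c → Anc parent b c → Anc parent a b ⊎ Anc parent b a
  anc-comparable anc-refl d' = inj₂ d'
  anc-comparable d@(anc-step _ _) anc-refl = inj₁ d
  anc-comparable (anc-step e d) (anc-step e' d') with parent-unique e e'
  ... | refl = anc-comparable d d'

  anc? : ∀ a b → Dec (Anc parent a b)
  anc? a b = along (reaches b)
    where
    along : ∀ {c} → Anc parent root c → Dec (Anc parent a c)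
    along anc-refl with a ≟ root
    ... | yes refl = yes anc-refl
    ... | no a≢root = no λ { anc-refl → a≢root refl ; (anc-step e _) → parent⇒¬anc-root e anc-refl }
    along {c} (anc-step e d) with a ≟ c | along d
    ... | yes refl | _ = yes anc-refl
    ... | no _ | yes a≼w = yes (anc-step e a≼w)
    ... | no a≢c | no a⋠w =
      no λ { anc-refl → a≢c refl ; (anc-step e' d') → a⋠w (subst (Anc parent a) (parent-unique e' e) d') }

module _ {n : ℕ} where

  Before-∷ : ∀ {σ : List (Fin n)} {a b c} → Before σ a b → Before (c ∷ σ) a b
  Before-∷ {c = c} (L₁ , L₂ , L₃ , refl) = c ∷ L₁ , L₂ , L₃ , refl

  Before-head : ∀ {σ : List (Fin n)} {a b} → b ∈ σ → Before (a ∷ σ) a b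
  Before-head b∈σ with ∈-∃++ b∈σ
  ... | L₂ , L₃ , refl = [] , L₂ , L₃ , refl

  Before⇒∈ˡ : ∀ {σ : List (Fin n)} {a b} → Before σ a b → a ∈ σ
  Before⇒∈ˡ (L₁ , _ , _ , refl) = ∈-++⁺ʳ L₁ (here refl)

  Before⇒∈ʳ : ∀ {σ : List (Fin n)} {a b} → Before σ a b → b ∈ σ
  Before⇒∈ʳ (L₁ , L₂ , _ , refl) = ∈-++⁺ʳ L₁ (there (∈-++⁺ʳ L₂ (here refl)))

  AllPairs-Before : ∀ {R : Fin n → Fin n → Set} {σ a b} → AllPairs R σ → Before σ a b → R a b
  AllPairs-Before (Ra ∷ _) ([] , L₂ , _ , refl) = All.lookup Ra (∈-++⁺ʳ L₂ (here refl))
  AllPairs-Before (_ ∷ Rσ) (_ ∷ L₁ , L₂ , L₃ , refl) = AllPairs-Before Rσ (L₁ , L₂ , L₃ , refl)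

  Before-total : ∀ {σ : List (Fin n)} {a b} → a ∈ σ → b ∈ σ → a ≢ b → Before σ a b ⊎ Before σ b a
  Before-total (here refl) (here refl) a≢b = contradiction refl a≢b
  Before-total (here refl) (there b∈σ) _ = inj₁ (Before-head b∈σ)
  Before-total (there a∈σ) (here refl) _ = inj₂ (Before-head a∈σ)
  Before-total (there a∈σ) (there b∈σ) a≢b with Before-total a∈σ b∈σ a≢b
  ... | inj₁ ab = inj₁ (Before-∷ ab)
  ... | inj₂ ba = inj₂ (Before-∷ ba)

  module _ {Y : VSet n} (Y? : ∀ v → Dec (Y v)) where

    downClosed⇒split : ∀ σ → (∀ b c → Before σ b c → Y c → Y b) →
                       ∃₂ λ P R → σ ≡ P ++ R × All Y P × All (λ v → ¬ Y v) R
    downClosed⇒split [] _ = [] , [] , refl , [] , []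
    downClosed⇒split (a ∷ σ) closed with Y? a
    ... | no ¬ya = [] , a ∷ σ , refl , [] , ¬ya ∷ All.tabulate (λ c∈σ yc → ¬ya (closed _ _ (Before-head c∈σ) yc))
    ... | yes ya with downClosed⇒split σ (λ b c bc → closed b c (Before-∷ bc))
    ...   | P , R , refl , yP , ¬yR = a ∷ P , R , refl , ya ∷ yP , ¬yR

    convex⇒consecutive : ∀ σ → (∀ v → Y v → v ∈ σ) →
                         (∀ a b c → Before σ a b → Before σ b c → Y a → Y c → Y b) →
                         Consecutive σ Y
    convex⇒consecutive [] Y⊆σ _ = [] , [] , [] , refl , λ v → (λ ()) , Y⊆σ v
    convex⇒consecutive (a ∷ σ) Y⊆σ convex with Y? a
    ... | no ¬ya
      with convex⇒consecutive σ (λ v yv → Any.tail (λ { refl → ¬ya yv }) (Y⊆σ v yv))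
             (λ a b c ab bc → convex a b c (Before-∷ ab) (Before-∷ bc))
    ...   | L , M , R , refl , M≐Y = a ∷ L , M , R , refl , M≐Y
    convex⇒consecutive (a ∷ σ) Y⊆σ convex | yes ya
      with downClosed⇒split σ (λ b c bc yc → convex a b c (Before-head (Before⇒∈ˡ bc)) (Before-∷ bc) ya yc)
    ... | P , R , refl , yP , ¬yR = [] , a ∷ P , R , refl , λ v → P⇒Y v , Y⇒P v
      where
      P⇒Y : ∀ v → v ∈ a ∷ P → Y v
      P⇒Y v (here refl) = ya
      P⇒Y v (there v∈P) = All.lookup yP v∈P
      Y⇒P : ∀ v → Y v → v ∈ a ∷ P
      Y⇒P v yv with Y⊆σ v yv
      ... | here refl = here refl
      ... | there v∈P++R with ∈-++⁻ P v∈P++R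
      ...   | inj₁ v∈P = there v∈P
      ...   | inj₂ v∈R = contradiction yv (All.lookup ¬yR v∈R)

⊆-or-counterexample : ∀ {n} {P Q : VSet n} → (∀ v → Dec (P v)) → (∀ v → Dec (Q v)) →
                      P ⊆ Q ⊎ ∃[ v ] (P v × ¬ Q v)
⊆-or-counterexample {n} P? Q? with all? (λ v → P? v →-dec Q? v)
... | yes P⊆Q = inj₁ P⊆Q
... | no P⊈Q with ¬∀⟶∃¬ n _ (λ v → P? v →-dec Q? v) P⊈Q
...   | v , ¬P⇒Q with P? v | Q? v
...     | yes pv | no ¬qv = inj₂ (v , pv , ¬qv)
...     | yes _ | yes qv = contradiction (λ _ → qv) ¬P⇒Q
...     | no ¬pv | _ = contradiction (λ pv → contradiction pv ¬pv) ¬P⇒Q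

module GraphLemmas {n : ℕ} (G : Graph n) where

  E? : ∀ u v → Dec (E G u v)
  E? u v = T? (Graph.adj G u v)

  E-sym : ∀ {u v} → E G u v → E G v u
  E-sym {u} {v} = subst T (Graph.sym G u v)

  E⇒≢ : ∀ {u v} → E G u v → u ≢ v
  E⇒≢ {u} e refl = subst T (Graph.irrefl G u) e

  Reach-head : ∀ {W u v} → Reach G W u v → W u
  Reach-head (here wu) = wu
  Reach-head (step wu _ _) = wu

  Reach-last : ∀ {W u v} → Reach G W u v → W v
  Reach-last (here wv) = wv
  Reach-last (step _ _ r) = Reach-last r

  Reach-snoc : ∀ {W u v w} → Reach G W u v → W w → E G v w → Reach G W u w
  Reach-snoc (here wu) ww e = step wu e (here ww)
  Reach-snoc (step wu e' r) ww e = step wu e' (Reach-snoc r ww e)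

  Reach-sym : ∀ {W u v} → Reach G W u v → Reach G W v u
  Reach-sym (here wu) = here wu
  Reach-sym (step wu e r) = Reach-snoc (Reach-sym r) wu (E-sym e)

  Reach-exit : ∀ {W a c} {P : VSet n} → (∀ v → Dec (P v)) → Reach G W a c → P a → ¬ P c →
               ∃₂ λ u z → P u × ¬ P z × E G u z
  Reach-exit P? (here _) pa ¬pc = contradiction pa ¬pc
  Reach-exit P? (step {w = w} _ e r) pa ¬pc with P? w
  ... | yes pw = Reach-exit P? r pw ¬pc
  ... | no ¬pw = _ , w , pa , ¬pw , e

module Layout {n : ℕ} {G : Graph n} (L : TreeLayout G) where
  open TreeLayout L
  open RootedTree tree
  open AncestorOrder tree
  open GraphLemmas G

  infix 4 _≼_ _≺_

  _≼_ : Fin n → Fin n → Set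
  u ≼ v = Anc parent (ρ u) (ρ v)

  _≺_ : Fin n → Fin n → Set
  _≺_ = Prec L

  ρ-injective : ∀ {u v} → ρ u ≡ ρ v → u ≡ v
  ρ-injective = proj₁ ρ-bij

  vertexAt : Fin n → Fin n
  vertexAt t = proj₁ (proj₂ ρ-bij t)

  ρ-vertexAt : ∀ t → ρ (vertexAt t) ≡ t
  ρ-vertexAt t = proj₂ (proj₂ ρ-bij t) refl

  ≼∧≢⇒≺ : ∀ {u v} → u ≼ v → u ≢ v → u ≺ v
  ≼∧≢⇒≺ d u≢v = d , λ e → u≢v (ρ-injective e)

  parent⇒≺ : ∀ {y y'} → parent (ρ y) ≡ just (ρ y') → y' ≺ y
  parent⇒≺ = parent-proper

  ≺⇒≢ : ∀ {u v} → u ≺ v → u ≢ v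
  ≺⇒≢ (_ , ρu≢ρv) refl = ρu≢ρv refl

  ≺-trans : ∀ {a b c} → a ≺ b → b ≺ c → a ≺ c
  ≺-trans {b = b} (ab , ρa≢ρb) (bc , _) =
    anc-trans ab bc , λ ρa≡ρc → ρa≢ρb (anc-antisym ab (subst (Anc parent (ρ b)) (sym ρa≡ρc) bc))

  ≺-≼-trans : ∀ {a b c} → a ≺ b → b ≼ c → a ≺ c
  ≺-≼-trans {b = b} {c} ab bc with b ≟ c
  ... | yes refl = ab
  ... | no b≢c = ≺-trans ab (≼∧≢⇒≺ bc b≢c)

  ≺-asym : ∀ {a b} → a ≺ b → ¬ b ≺ a
  ≺-asym ab ba = ≺⇒≢ (≺-trans ab ba) refl

  ≺-comparable : ∀ {a b c} → a ≼ c → b ≼ c → a ≢ b → a ≺ b ⊎ b ≺ a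
  ≺-comparable ac bc a≢b with anc-comparable ac bc
  ... | inj₁ ab = inj₁ (≼∧≢⇒≺ ab a≢b)
  ... | inj₂ ba = inj₂ (≼∧≢⇒≺ ba λ { refl → a≢b refl })

  edge⇒≺ : ∀ {u v} → E G u v → u ≺ v ⊎ v ≺ u
  edge⇒≺ {u} {v} e with edges u v e
  ... | inj₁ uv = inj₁ (≼∧≢⇒≺ uv (E⇒≢ e))
  ... | inj₂ vu = inj₂ (≼∧≢⇒≺ vu (E⇒≢ (E-sym e)))

  ≼? : ∀ u v → Dec (u ≼ v)
  ≼? u v = anc? (ρ u) (ρ v)

  ≺? : ∀ u v → Dec (u ≺ v)
  ≺? u v = ≼? u v ×-dec ¬? (ρ u ≟ ρ v)

  vertexDepth : Fin n → ℕ
  vertexDepth v = depth (ρ v)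

  ≺⇒vertexDepth-< : ∀ {u v} → u ≺ v → vertexDepth u < vertexDepth v
  ≺⇒vertexDepth-< (uv , ρu≢ρv) = depth-< uv ρu≢ρv

module Indifference {n : ℕ} {G : Graph n} (L : TreeLayout G) (indifference : IndifferenceLayout L) where
  open TreeLayout L
  open RootedTree tree
  open AncestorOrder tree
  open GraphLemmas G
  open Layout L

  indifferent : ∀ {a b c} → a ≺ b → b ≺ c → E G a c → E G a b × E G b c
  indifferent {a} {b} {c} ab bc ac =
    decidable-stable (E? a b) (λ ¬ab → indifference a b c ab bc ac (inj₁ ¬ab)) ,
    decidable-stable (E? b c) (λ ¬bc → indifference a b c ab bc ac (inj₂ ¬bc))

  indifferentˡ : ∀ {a b c} → a ≺ b → b ≼ c → E G a c → E G a b
  indifferentˡ {b = b} {c} ab bc ac with b ≟ c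
  ... | yes refl = ac
  ... | no b≢c = proj₁ (indifferent ab (≼∧≢⇒≺ bc b≢c) ac)

  indifferentʳ : ∀ {a b c} → a ≼ b → b ≺ c → E G a c → E G b c
  indifferentʳ {a} {b} ab bc ac with a ≟ b
  ... | yes refl = ac
  ... | no a≢b = proj₂ (indifferent (≼∧≢⇒≺ ab a≢b) bc ac)

  comparable⇒adjacent : ∀ {s y u} → s ≺ y → s ≺ u → E G s y → E G s u → y ≺ u ⊎ u ≺ y → E G y u
  comparable⇒adjacent sy _ _ su (inj₁ yu) = proj₂ (indifferent sy yu su)
  comparable⇒adjacent _ su sy _ (inj₂ uy) = E-sym (proj₂ (indifferent su uy sy))

  -- In a connected graph, the walk from y to the root must leave the subtree of y
  -- along an edge zu with z ≺ y ≼ u; indifference pulls that edge up to the parent.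
  parent-adjacent : Connected G → ∀ {y y'} → parent (ρ y) ≡ just (ρ y') → E G y y'
  parent-adjacent connected {y} {y'} py
    with Reach-exit (≼? y) (connected y (vertexAt root)) anc-refl
           (λ y≼root → parent⇒¬anc-root py (subst (Anc parent (ρ y)) (ρ-vertexAt root) y≼root))
  ... | u , z , y≼u , y⋠z , uz = E-sym (indifferentʳ z≼y' y'≺y zy)
    where
    z≺u : z ≺ u
    z≺u with edge⇒≺ uz
    ... | inj₁ (u≼z , _) = contradiction (anc-trans y≼u u≼z) y⋠z
    ... | inj₂ z≺u = z≺u
    z≺y : z ≺ y
    z≺y with ≺-comparable (proj₁ z≺u) y≼u (λ { refl → y⋠z anc-refl })
    ... | inj₁ z≺y = z≺y
    ... | inj₂ (y≼z , _) = contradiction y≼z y⋠z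
    zy : E G z y
    zy = indifferentˡ z≺y y≼u (E-sym uz)
    y'≺y : y' ≺ y
    y'≺y = parent⇒≺ py
    z≼y' : z ≼ y'
    z≼y' = anc-parent (proj₁ z≺y) (proj₂ z≺y) py

module BlockStructure {n : ℕ} {G : Graph n} (connected : Connected G) (L : TreeLayout G)
               (indifference : IndifferenceLayout L) (x : Fin n) (x-nonroot : ¬ IsRootVertex L x) where
  open TreeLayout L
  open RootedTree tree
  open AncestorOrder tree
  open GraphLemmas G
  open Layout L
  open Indifference L indifference

  S : VSet n
  S = A L x

  C : VSet n
  C = CompMinus G S x

  Bl : VSet n
  Bl = Block G S C

  Bx : VSet n
  Bx = Bset L x

  W : VSet n
  W v = C v × ¬ Bx v

  NB : Fin n → VSet n
  NB y b = Bx b × E G y b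

  parentOfx : ∃[ p ] parent (ρ x) ≡ just (ρ p)
  parentOfx with reaches (ρ x)
  ... | anc-refl = contradiction refl x-nonroot
  ... | anc-step {w = w} e _ = vertexAt w , trans e (cong just (sym (ρ-vertexAt w)))

  x∈C : C x
  x∈C = here (λ x≺x → ≺⇒≢ x≺x refl)

  C⇒≼ : ∀ {v} → C v → x ≼ v
  C⇒≼ = go anc-refl
    where
    go : ∀ {u v} → x ≼ u → Reach G (λ w → ¬ S w) u v → x ≼ v
    go x≼u (here _) = x≼u
    go x≼u (step {w = w} _ uw r) = go x≼w r
      where
      x≼w : x ≼ w
      x≼w with edge⇒≺ uw
      ... | inj₁ (u≼w , _) = anc-trans x≼u u≼w
      ... | inj₂ (w≼u , _) with anc-comparable x≼u w≼u | w ≟ x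
      ...   | inj₁ x≼w | _ = x≼w
      ...   | inj₂ _ | yes refl = anc-refl
      ...   | inj₂ w≼x | no w≢x = contradiction (≼∧≢⇒≺ w≼x w≢x) (Reach-head r)

  ≼⇒C : ∀ {v} → x ≼ v → C v
  ≼⇒C d = go d refl
    where
    go : ∀ {t v} → Anc parent (ρ x) t → ρ v ≡ t → C v
    go anc-refl e with ρ-injective e
    ... | refl = x∈C
    go {v = v} (anc-step {w = w} e d) refl =
      Reach-snoc (go d (ρ-vertexAt w)) v∉S (E-sym (parent-adjacent connected pv))
      where
      pv : parent (ρ v) ≡ just (ρ (vertexAt w))
      pv = trans e (cong just (sym (ρ-vertexAt w)))
      v∉S : ¬ S v
      v∉S v≺x = ≺⇒≢ (≺-≼-trans v≺x (anc-step e d)) refl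

  C? : ∀ v → Dec (C v)
  C? v = map′ ≼⇒C C⇒≼ (≼? x v)

  S≺C : ∀ {s y} → S s → C y → s ≺ y
  S≺C s≺x cy = ≺-≼-trans s≺x (C⇒≼ cy)

  Bx⇒Bl : ∀ {v} → Bx v → Bl v
  Bx⇒Bl (inj₁ (x-root , _)) = contradiction x-root x-nonroot
  Bx⇒Bl (inj₂ (_ , bv)) = bv

  Bl⇒Bx : ∀ {v} → Bl v → Bx v
  Bl⇒Bx bv = inj₂ (x-nonroot , bv)

  Bx? : ∀ v → Dec (Bx v)
  Bx? v = map′ Bl⇒Bx Bx⇒Bl (C? v ×-dec (C? v ×-dec maximal?) ×-dec universal?)
    where
    maximal? : Dec (∀ w → C w → ∀ s → S s → E G w s → E G v s)
    maximal? = all? λ w → C? w →-dec all? λ s → ≺? s x →-dec (E? w s →-dec E? v s)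
    Nbh? : ∀ u → Dec (Nbh G S u)
    Nbh? u = ¬? (≺? u x) ×-dec any? λ s → ≺? s x ×-dec E? u s
    universal? : Dec (Universal G (λ u → Nbh G S u × C u) v)
    universal? = all? λ u → (Nbh? u ×-dec C? u) →-dec (¬? (u ≟ v) →-dec E? v u)

  NB? : ∀ y b → Dec (NB y b)
  NB? y b = Bx? b ×-dec E? y b

  block-upward : ∀ {y b} → C y → Bl b → y ≺ b → Bl y
  block-upward {y} {b} cy (_ , (_ , b-maximal) , b-universal) y≺b = cy , (cy , y-maximal) , y-universal
    where
    y-maximal : ∀ w → C w → ∀ s → S s → E G w s → E G y s
    y-maximal w cw s s≺x ws = E-sym (proj₁ (indifferent (S≺C s≺x cy) y≺b (E-sym (b-maximal w cw s s≺x ws))))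
    y-universal : ∀ u → Nbh G S u × C u → u ≢ y → E G y u
    y-universal u nu@((_ , s , s≺x , us) , cu) u≢y =
      comparable⇒adjacent s≺y (S≺C s≺x cu) sy (E-sym us) y≍u
      where
      s≺y : s ≺ y
      s≺y = S≺C s≺x cy
      sy : E G s y
      sy = proj₁ (indifferent s≺y y≺b (E-sym (b-maximal u cu s s≺x us)))
      y≍u : y ≺ u ⊎ u ≺ y
      y≍u with u ≟ b
      ... | yes refl = inj₁ y≺b
      ... | no u≢b with edge⇒≺ (b-universal u nu u≢b)
      ...   | inj₁ b≺u = inj₁ (≺-trans y≺b b≺u)
      ...   | inj₂ u≺b = ≺-comparable (proj₁ y≺b) (proj₁ u≺b) (u≢y ∘′ sym)

  -- Every vertex of the block sees the parent of x, because x does and it is S-maximal.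
  block-clique : ∀ {b b'} → Bl b → Bl b' → b' ≢ b → E G b b'
  block-clique (_ , _ , b-universal) (cb' , (_ , b'-maximal) , _) b'≢b =
    b-universal _ ((Reach-last cb' , p , parent⇒≺ px , b'-maximal x x∈C p (parent⇒≺ px) xp) , cb') b'≢b
    where
    p : Fin n
    p = proj₁ parentOfx
    px : parent (ρ x) ≡ just (ρ p)
    px = proj₂ parentOfx
    xp : E G x p
    xp = parent-adjacent connected px

  block-chain : ∀ {b b'} → Bx b → Bx b' → b ≢ b' → b ≺ b' ⊎ b' ≺ b
  block-chain bb bb' b≢b' = edge⇒≺ (block-clique (Bx⇒Bl bb) (Bx⇒Bl bb') (b≢b' ∘′ sym))

  neighbour-≺ : ∀ {y b} → W y → NB y b → b ≺ y
  neighbour-≺ (cy , y∉B) (bb , yb) with edge⇒≺ yb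
  ... | inj₁ y≺b = contradiction (Bl⇒Bx (block-upward cy (Bx⇒Bl bb) y≺b)) y∉B
  ... | inj₂ b≺y = b≺y

  ≺-W-step : ∀ {b u w} → Bx b → W u → W w → E G u w → b ≺ u → b ≺ w
  ≺-W-step bb _ (cw , w∉B) uw b≺u with edge⇒≺ uw
  ... | inj₁ u≺w = ≺-trans b≺u u≺w
  ... | inj₂ w≺u with ≺-comparable (proj₁ b≺u) (proj₁ w≺u) (λ { refl → w∉B bb })
  ...   | inj₁ b≺w = b≺w
  ...   | inj₂ w≺b = contradiction (Bl⇒Bx (block-upward cw (Bx⇒Bl bb) w≺b)) w∉B

  ≺-Reach : ∀ {b u v} → Bx b → Reach G W u v → b ≺ u → b ≺ v
  ≺-Reach bb (here _) b≺u = b≺u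
  ≺-Reach bb (step wu uw r) b≺u = ≺-Reach bb r (≺-W-step bb wu (Reach-head r) uw b≺u)

  neighbour-≺-component : ∀ {i y y' b} → Reach G W i y → Reach G W i y' → NB y b → b ≺ y'
  neighbour-≺-component i⇝y i⇝y' nb =
    ≺-Reach (proj₁ nb) i⇝y' (≺-Reach (proj₁ nb) (Reach-sym i⇝y) (neighbour-≺ (Reach-last i⇝y) nb))

  NB-upward : ∀ {y b b'} → NB y b → Bx b' → b ≺ b' → b' ≺ y → NB y b'
  NB-upward (_ , yb) bb' b≺b' b'≺y = bb' , E-sym (proj₂ (indifferent b≺b' b'≺y (E-sym yb)))

  private
    byDepth = On.decTotalOrder ≤-decTotalOrder vertexDepth
    module ByDepth = Sort byDepth

  σ : List (Fin n)
  σ = ByDepth.sort (filter Bx? (allFin n))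

  ∈σ⇔Bx : ∀ v → (v ∈ σ → Bx v) × (Bx v → v ∈ σ)
  ∈σ⇔Bx v = (λ v∈σ → proj₂ (∈-filter⁻ Bx? {xs = allFin n} (∈-resp-↭ (ByDepth.sort-↭ _) v∈σ))) ,
            (λ bv → ∈-resp-↭ (↭-sym (ByDepth.sort-↭ _)) (∈-filter⁺ Bx? (∈-allFin v) bv))

  σ-unique : Unique σ
  σ-unique = SetoidPermutation.Unique-resp-↭ (setoid (Fin n)) (↭⇒↭ₛ (↭-sym (ByDepth.sort-↭ _)))
               (filter⁺ Bx? (allFin⁺ n))

  σ-sorted : AllPairs (λ u v → vertexDepth u ≤ vertexDepth v) σ
  σ-sorted = Sorted⇒AllPairs (DecTotalOrder.totalOrder byDepth) (ByDepth.sort-↗ _)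

  Before⇒≺ : ∀ {a b} → Before σ a b → a ≺ b
  Before⇒≺ ab with block-chain (proj₁ (∈σ⇔Bx _) (Before⇒∈ˡ ab)) (proj₁ (∈σ⇔Bx _) (Before⇒∈ʳ ab))
                                (AllPairs-Before σ-unique ab)
  ... | inj₁ a≺b = a≺b
  ... | inj₂ b≺a = contradiction (AllPairs-Before σ-sorted ab) (<⇒≱ (≺⇒vertexDepth-< b≺a))

  ≺⇒Before : ∀ {a b} → Bx a → Bx b → a ≺ b → Before σ a b
  ≺⇒Before ba bb a≺b with Before-total (proj₂ (∈σ⇔Bx _) ba) (proj₂ (∈σ⇔Bx _) bb) (≺⇒≢ a≺b)
  ... | inj₁ ab = ab
  ... | inj₂ ba = contradiction (Before⇒≺ ba) (≺-asym a≺b)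

  NB-nested : ∀ {i y y'} → Reach G W i y → Reach G W i y' → NB y ⊆ NB y' ⊎ NB y' ⊆ NB y
  NB-nested {y = y} {y'} i⇝y i⇝y' with ⊆-or-counterexample (NB? y) (NB? y')
  ... | inj₁ y⊆y' = inj₁ y⊆y'
  ... | inj₂ (b , nb , ¬nb') = inj₂ y'⊆y
    where
    y'⊆y : NB y' ⊆ NB y
    y'⊆y b' nb'@(bb' , _) with block-chain (proj₁ nb) bb' (λ { refl → ¬nb' nb' })
    ... | inj₁ b≺b' = NB-upward nb bb' b≺b' (neighbour-≺-component i⇝y' i⇝y nb')
    ... | inj₂ b'≺b = contradiction (NB-upward nb' (proj₁ nb) b'≺b (neighbour-≺-component i⇝y i⇝y' nb)) ¬nb'

  NB-consecutive : ∀ {y} → W y → Consecutive σ (NB y)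
  NB-consecutive {y} wy = convex⇒consecutive (NB? y) σ (λ v nv → proj₂ (∈σ⇔Bx v) (proj₁ nv)) convex
    where
    convex : ∀ a b c → Before σ a b → Before σ b c → NB y a → NB y c → NB y b
    convex a b c ab bc na nc =
      NB-upward na (proj₁ (∈σ⇔Bx b) (Before⇒∈ʳ ab)) (Before⇒≺ ab) (≺-trans (Before⇒≺ bc) (neighbour-≺ wy nc))

  NB-ordered : ∀ {i y y' v w} → Reach G W i y → Reach G W i y' →
               NB y v → ¬ NB y' v → NB y' w → Before σ v w
  NB-ordered i⇝y i⇝y' nv@(bv , _) ¬nv' nw@(bw , _) with block-chain bv bw (λ { refl → ¬nv' nw })
  ... | inj₁ v≺w = ≺⇒Before bv bw v≺w
  ... | inj₂ w≺v = contradiction (NB-upward nw bv w≺v (neighbour-≺-component i⇝y i⇝y' nv)) ¬nv'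

mainTheorem14 : ∀ {n} (G : Graph n) → Connected G → ProperChordal G →
  (L : TreeLayout G) → IndifferenceLayout L →
  (x : Fin n) → ¬ IsRootVertex L x →
  (∀ y → Bset L x ⊆ Bset L y → Bset L y ⊆ Bset L x) →
  let Cx : VSet n
      Cx = CompMinus G (A L x) x
      W : VSet n
      W v = Cx v × ¬ Bset L x v
      NB : Fin n → VSet n
      NB y b = Bset L x b × E G y b
      I : Set
      I = Σ (Fin n) W
      M : I → Set
      M i = Σ (Fin n) (λ y → Reach G W (proj₁ i) y × ∃[ b ] NB y b)
      F : (i : I) → M i → VSet n
      F i m = NB (proj₁ m)
  in (∀ i → Nested (M i) (F i)) ×
     Σ (List (Fin n)) (NestedConvex (Bset L x) I M F)
mainTheorem14 G connected _ L indifference x x-nonroot _ =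
  (λ { _ (_ , i⇝y , _) (_ , i⇝y' , _) → NB-nested i⇝y i⇝y' }) ,
  σ ,
  (σ-unique , ∈σ⇔Bx) ,
  (λ { _ (_ , i⇝y , _) → NB-consecutive (Reach-last i⇝y) }) ,
  (λ { _ (_ , i⇝y , _) (_ , i⇝y' , _) _ _ _ → NB-ordered i⇝y i⇝y' })
  where
  open GraphLemmas G
  open BlockStructure connected L indifference x x-nonroot
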